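{- Let $H=T\cup C$ be a Halin graph whose accompanying cycle $C$ has edges ordered as $e_1,\ldots,e_p$, and run the procedure $\mathrm{LIST}(H)$ described in the context. Then every spanning tree of $H$ is output by $\mathrm{LIST}(H)$ at least once.
   Context: A Halin graph $H=T\cup C$ is obtained from a tree $T$ (the characteristic tree) that has no vertex of degree two and at least three leaves, by adding a cycle $C$ (the accompanying cycle) through all leaves of $T$, in the cyclic order of a plane embedding of $T$. Let $p$ be the number of leaves, and fix an ordering $e_1,\ldots,e_p$ of the edges of $C$. Procedure $\mathrm{REC}(T',i)$, for a spanning tree $T'$ of $H$ and an index $i$: let $G^*=T'+e_i$ and let $C^*$ be the unique cycle of $G^*$ (it contains $e_i$); for each edge $b\in E(C^*)\setminus E(C)$, let $T^*=G^*-b$, output $T^*$, and then call $\mathrm{REC}(T^*,j)$ for every $j=i+1,\ldots,p$. Procedure $\mathrm{LIST}(H)$: output $T$, then call $\mathrm{REC}(T,i)$ for every $i=1,\ldots,p$. -}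

module Defs where

open import Data.Nat using (ℕ; zero; suc; _<_; _≤_; _+_)
open import Data.Fin using (Fin; toℕ; _≟_)
open import Data.Fin.Subset using (Subset; _∈_; _∉_; _∪_; ⁅_⁆; _-_)
open import Data.Vec using (lookup)
open import Data.Bool using (Bool; true; false; if_then_else_; _∧_; _∨_)
open import Data.List using (List; []; _∷_; map; allFin)
open import Data.Nat.ListAction using (sum)
open import Data.List.Membership.Propositional as LM using ()
open import Data.List.Relation.Unary.Unique.Propositional using (Unique)
open import Data.Product using (Σ; ∃; _×_; _,_; proj₁; proj₂)
open import Data.Sum using (_⊎_)
open import Data.Empty using (⊥)
import Data.Nat.Properties
import Data.Fin.Properties
import Data.List
open import Function using (Injective)
open import Relation.Nullary using (¬_; does)
open import Relation.Binary.PropositionalEquality using (_≡_; _≢_)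

-- A finite (multi)graph on vertex set Fin n with edges indexed by Fin m;
-- `ends i` gives the two end vertices of edge i.  Edge sets (subgraphs) are
-- subsets of the edge index set Fin m.

module _ {n m : ℕ} (ends : Fin m → Fin n × Fin n) where

  Joins : Fin m → Fin n → Fin n → Set
  Joins i u w = (ends i ≡ (u , w)) ⊎ (ends i ≡ (w , u))

  data Conn (S : Subset m) : Fin n → Fin n → Set where
    here : ∀ {u} → Conn S u u
    step : ∀ {u w v} (i : Fin m) → i ∈ S → Joins i u w → Conn S w v → Conn S u v

  -- S is a spanning tree: connected on all of Fin n and acyclic, where
  -- acyclic means no edge of S lies on a cycle of S, i.e. for every edge of S
  -- its ends are disconnected once the edge is deleted (this also forbids loops
  -- and parallel edges).
  IsSpanningTree : Subset m → Set
  IsSpanningTree S =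
    (∀ u v → Conn S u v) ×
    (∀ i → i ∈ S → ¬ Conn (S - i) (proj₁ (ends i)) (proj₂ (ends i)))

  deg : Subset m → Fin n → ℕ
  deg S v = sum (map f (allFin m))
    where
    f : Fin m → ℕ
    f i = if lookup S i ∧ (does (v ≟ proj₁ (ends i)) ∨ does (v ≟ proj₂ (ends i)))
          then 1 else 0

  OnCycle : Subset m → Fin m → Set
  OnCycle G b = (b ∈ G) × Conn (G - b) (proj₁ (ends b)) (proj₂ (ends b))

-- Rotation systems (combinatorial plane embeddings of a graph).
-- cyclic successor of u in the cyclic list xs (u itself if u ∉ xs)
succIn : ∀ {n} → List (Fin n) → Fin n → Fin n
succIn {n} xs u = go xs
  where
  first : List (Fin n) → Fin n
  first []      = u
  first (y ∷ _) = y
  go : List (Fin n) → Fin n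
  go [] = u
  go (y ∷ ys) with does (y ≟ u)
  ... | true  = first (ys Data.List.++ xs)
  ... | false = go ys

-- face-tracing step on darts: dart (u , v) goes to (v , successor of u at v)
nextDart : ∀ {n} → (Fin n → List (Fin n)) → Fin n × Fin n → Fin n × Fin n
nextDart rot (u , v) = (v , succIn (rot v) u)

iterDart : ∀ {n} → (Fin n → List (Fin n)) → ℕ → Fin n × Fin n → Fin n × Fin n
iterDart rot zero    d = d
iterDart rot (suc k) d = iterDart rot k (nextDart rot d)

sucMod : ∀ {p} → Fin p → Fin p
sucMod {suc p} i with Data.Nat._≟_ (suc (toℕ i)) (suc p)
... | Relation.Nullary.yes _ = Data.Fin.zero
... | Relation.Nullary.no ne = Data.Fin.fromℕ< (Data.Nat.Properties.≤∧≢⇒< (Data.Fin.Properties.toℕ<n i) ne)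

-- A Halin graph H = T ∪ C on vertex set Fin n with edges Fin m, whose
-- characteristic tree has p leaves.
record Halin (n m p : ℕ) : Set where
  field
    ends   : Fin m → Fin n × Fin n
    T      : Subset m
    C      : Subset m
    T⊎C    : ∀ i → (i ∈ T × i ∉ C) ⊎ (i ∉ T × i ∈ C)
    T-tree : IsSpanningTree ends T
    no-deg2 : ∀ v → deg ends T v ≢ 2
    leaf        : Fin p → Fin n
    leaf-inj    : Injective _≡_ _≡_ leaf
    leaf-isLeaf : ∀ k → deg ends T (leaf k) ≡ 1
    leaf-all    : ∀ v → deg ends T v ≡ 1 → ∃ λ k → leaf k ≡ v
    three-leaves : 3 ≤ p
    -- a plane embedding of T, given as a rotation system: rot v lists the
    -- T-neighbours of v (without repetition) in clockwise order
    rot        : Fin n → List (Fin n)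
    rot-unique : ∀ v → Unique (rot v)
    rot-nbrs   : ∀ v w → w LM.∈ rot v → ∃ λ i → i ∈ T × Joins ends i v w
    nbrs-rot   : ∀ v w i → i ∈ T → Joins ends i v w → w LM.∈ rot v
    -- the cyclic order of the leaves is the one induced by the embedding:
    -- tracing the (unique) face of the embedded tree, starting with the dart
    -- from leaf k to its neighbour, the next leaf reached is leaf (k+1 mod p)
    leaf-order : ∀ k → ∃ λ w → (∃ λ i → i ∈ T × Joins ends i (leaf k) w) ×
                   (∃ λ t → (proj₂ (iterDart rot t (leaf k , w)) ≡ leaf (sucMod k)) ×
                      (∀ s → s < t → deg ends T (proj₂ (iterDart rot s (leaf k , w))) ≢ 1))
    cyc-edge   : ∀ k → ∃ λ i → i ∈ C × Joins ends i (leaf k) (leaf (sucMod k))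
    cyc-uniq   : ∀ k i j → i ∈ C → j ∈ C → Joins ends i (leaf k) (leaf (sucMod k)) →
                   Joins ends j (leaf k) (leaf (sucMod k)) → i ≡ j
    cyc-only   : ∀ i → i ∈ C → ∃ λ k → Joins ends i (leaf k) (leaf (sucMod k))

-- An ordering e 1, …, e p of the edges of the accompanying cycle
-- (indices shifted to 0, …, p-1): a bijection Fin p → E(C).
module _ {n m p : ℕ} (H : Halin n m p) where
  open Halin H

  IsCycleOrdering : (Fin p → Fin m) → Set
  IsCycleOrdering e = Injective _≡_ _≡_ e × (∀ k → e k ∈ C) × (∀ i → i ∈ C → ∃ λ k → e k ≡ i)

  -- REC T' i outputs S  (G* = T' + e i,  T* = G* - b for b ∈ E(C*) ∖ E(C))
  data RecOutputs (e : Fin p → Fin m) (T' : Subset m) (i : Fin p) : Subset m → Set where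
    output : ∀ b → OnCycle ends (T' ∪ ⁅ e i ⁆) b → b ∉ C →
             RecOutputs e T' i ((T' ∪ ⁅ e i ⁆) - b)
    recurse : ∀ {S} b → OnCycle ends (T' ∪ ⁅ e i ⁆) b → b ∉ C →
              ∀ j → toℕ i < toℕ j → RecOutputs e ((T' ∪ ⁅ e i ⁆) - b) j S →
              RecOutputs e T' i S

  data ListOutputs (e : Fin p → Fin m) : Subset m → Set where
    output-T : ListOutputs e T
    via-REC  : ∀ {S} i → RecOutputs e T i S → ListOutputs e S

-- Run through the cycle edges e 0, …, e (p-1) in order, maintaining a spanning tree T′ that
-- LIST(H) outputs and for which every call REC(T′, j) with j at least the current index is
-- still made.  When e k ∈ S, some edge b ∉ S lies on the cycle of T′ + e k (otherwise S would
-- connect the ends of e k without it); b is not a cycle edge, because the only cycle edges of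
-- T′ are earlier edges of S.  So T′ + e k - b is output by REC(T′, k), and it agrees with S on
-- one more cycle edge while keeping every tree edge of S.  After p steps T′ contains S, hence
-- equals it.

module Submission where

open import Defs
open import Data.Nat using (ℕ; zero; suc; _<_; _≤_)
open import Data.Nat.Properties using (≤-refl; <-irrefl; <⇒≤; m<n⇒m<1+n; m<1+n⇒m<n∨m≡n)
open import Data.Nat.Induction using (<-wellFounded)
open import Induction.WellFounded using (Acc; acc)
open import Data.Fin using (Fin; toℕ; fromℕ<; _≟_)
open import Data.Fin.Properties using (toℕ-fromℕ<; toℕ-injective; toℕ<n)
open import Data.Fin.Subset using (Subset; _∈_; _∉_; _⊆_; _∪_; _∩_; _─_; _-_; ⁅_⁆; ∣_∣; inside)
open import Data.Fin.Subset.Properties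
  using (_∈?_; p⊆p∪q; x∈⁅x⁆; x∈⁅y⁆⇒x≡y; x∈p∪q⁺; x∈p∪q⁻; x∈p∩q⁺; x∈p∩q⁻; p─q⊆p; x∈p∧x≢y⇒x∈p-y; x∈p⇒∣p-x∣<∣p∣; ⊆-antisym)
open import Data.Vec.Base using (_∷_; here; there)
open import Data.Product using (∃; _×_; _,_; proj₁; proj₂; map₁; map₂)
open import Data.Sum using (_⊎_; inj₁; inj₂)
import Data.Sum as Sum
open import Data.Empty using (⊥; ⊥-elim)
open import Function using (_∘_)
open import Relation.Nullary using (¬_; yes; no)
open import Relation.Binary.PropositionalEquality using (_≡_; _≢_; refl; sym; subst)

x∈p─q⇒x∉q : ∀ {k} {x : Fin k} (p q : Subset k) → x ∈ p ─ q → x ∉ q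
x∈p─q⇒x∉q (_ ∷ p) (inside ∷ q) () here
x∈p─q⇒x∉q (_ ∷ p) (_ ∷ q) (there x∈p─q) (there x∈q) = x∈p─q⇒x∉q p q x∈p─q x∈q

x∈p-y⇒x∈p×x≢y : ∀ {k} {x y : Fin k} {p : Subset k} → x ∈ p - y → x ∈ p × x ≢ y
x∈p-y⇒x∈p×x≢y {y = y} {p} x∈p-y =
  p─q⊆p p ⁅ y ⁆ x∈p-y , λ { refl → x∈p─q⇒x∉q p ⁅ y ⁆ x∈p-y (x∈⁅x⁆ y) }

x∈p∪⁅y⁆⇒x∈p⊎x≡y : ∀ {k} {x y : Fin k} {p : Subset k} → x ∈ p ∪ ⁅ y ⁆ → x ∈ p ⊎ x ≡ y
x∈p∪⁅y⁆⇒x∈p⊎x≡y {y = y} {p} x∈ = Sum.map₂ (x∈⁅y⁆⇒x≡y y) (x∈p∪q⁻ p ⁅ y ⁆ x∈)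

p⊆q⇒p-x⊆q-x : ∀ {k} {x : Fin k} {p q : Subset k} → p ⊆ q → p - x ⊆ q - x
p⊆q⇒p-x⊆q-x p⊆q y∈ with x∈p-y⇒x∈p×x≢y y∈
... | y∈p , y≢x = x∈p∧x≢y⇒x∈p-y (p⊆q y∈p) y≢x

p⊆q⇒p∩r⊆q∩r : ∀ {k} {p q r : Subset k} → p ⊆ q → p ∩ r ⊆ q ∩ r
p⊆q⇒p∩r⊆q∩r {p = p} {r = r} p⊆q y∈ with x∈p∩q⁻ p r y∈
... | y∈p , y∈r = x∈p∩q⁺ (p⊆q y∈p , y∈r)

x∉q⇒p∩q⊆p-x : ∀ {k} {x : Fin k} {p q : Subset k} → x ∉ q → p ∩ q ⊆ p - x
x∉q⇒p∩q⊆p-x {p = p} {q} x∉q y∈ with x∈p∩q⁻ p q y∈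
... | y∈p , y∈q = x∈p∧x≢y⇒x∈p-y y∈p λ { refl → x∉q y∈q }

x∉p⇒p∩q⊆q-x : ∀ {k} {x : Fin k} {p q : Subset k} → x ∉ p → p ∩ q ⊆ q - x
x∉p⇒p∩q⊆q-x {p = p} {q} x∉p y∈ with x∈p∩q⁻ p q y∈
... | y∈p , y∈q = x∈p∧x≢y⇒x∈p-y y∈q λ { refl → x∉p y∈p }

p⊆p-x∪⁅x⁆ : ∀ {k} {x : Fin k} {p : Subset k} → p ⊆ (p - x) ∪ ⁅ x ⁆
p⊆p-x∪⁅x⁆ {_} {x} {_} {y} y∈p with y ≟ x
... | yes refl = x∈p∪q⁺ (inj₂ (x∈⁅x⁆ x))
... | no y≢x = x∈p∪q⁺ (inj₁ (x∈p∧x≢y⇒x∈p-y y∈p y≢x))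

module Walks {n m : ℕ} (ends : Fin m → Fin n × Fin n) where

  infix 4 _~[_]_

  _~[_]_ : Fin n → Subset m → Fin n → Set
  u ~[ S ] v = Conn ends S u v

  Connected : Subset m → Set
  Connected S = ∀ u v → u ~[ S ] v

  Acyclic : Subset m → Set
  Acyclic S = ∀ i → i ∈ S → ¬ proj₁ (ends i) ~[ S - i ] proj₂ (ends i)

  private
    variable
      S T Z G : Subset m
      i e b : Fin m
      a c s t u v w x y : Fin n

  joins-ends : ∀ i → Joins ends i (proj₁ (ends i)) (proj₂ (ends i))
  joins-ends i = inj₁ refl

  Joins-sym : Joins ends i a c → Joins ends i c a
  Joins-sym = Sum.swap

  Joins-endpoints : Joins ends i a c → Joins ends i s t → (a ≡ s × c ≡ t) ⊎ (a ≡ t × c ≡ s)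
  Joins-endpoints (inj₁ refl) (inj₁ refl) = inj₁ (refl , refl)
  Joins-endpoints (inj₁ refl) (inj₂ refl) = inj₂ (refl , refl)
  Joins-endpoints (inj₂ refl) (inj₁ refl) = inj₂ (refl , refl)
  Joins-endpoints (inj₂ refl) (inj₂ refl) = inj₁ (refl , refl)

  ~-edge : i ∈ S → Joins ends i a c → a ~[ S ] c
  ~-edge i∈S j = step _ i∈S j here

  ~-trans : a ~[ S ] w → w ~[ S ] c → a ~[ S ] c
  ~-trans here q = q
  ~-trans (step i i∈S j p) q = step i i∈S j (~-trans p q)

  ~-sym : a ~[ S ] c → c ~[ S ] a
  ~-sym here = here
  ~-sym (step i i∈S j p) = ~-trans (~-sym p) (~-edge i∈S (Joins-sym j))

  ~-mono : S ⊆ Z → a ~[ S ] c → a ~[ Z ] c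
  ~-mono S⊆Z here = here
  ~-mono S⊆Z (step i i∈S j p) = step i (S⊆Z i∈S) j (~-mono S⊆Z p)

  ~-across : Joins ends i a c → Joins ends i s t → a ~[ S ] c → s ~[ S ] t
  ~-across jac jst a~c with Joins-endpoints jac jst
  ... | inj₁ (refl , refl) = a~c
  ... | inj₂ (refl , refl) = ~-sym a~c

  acyclic-at : Acyclic S → i ∈ S → Joins ends i a c → ¬ a ~[ S - i ] c
  acyclic-at acyclic i∈S j a~c = acyclic _ i∈S (~-across j (joins-ends _) a~c)

  ~-∪⁅⁆ : Joins ends e s t → a ~[ Z ∪ ⁅ e ⁆ ] c →
          a ~[ Z ] c ⊎ ((a ~[ Z ] s ⊎ a ~[ Z ] t) × (s ~[ Z ] c ⊎ t ~[ Z ] c))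
  ~-∪⁅⁆ je here = inj₁ here
  ~-∪⁅⁆ je (step i i∈ ji rest) with x∈p∪⁅y⁆⇒x∈p⊎x≡y i∈ | ~-∪⁅⁆ je rest
  ... | inj₁ i∈Z | rest′ =
    Sum.map (step i i∈Z ji) (map₁ (Sum.map (step i i∈Z ji) (step i i∈Z ji))) rest′
  ... | inj₂ refl | rest′ with Joins-endpoints ji je
  ...   | inj₁ (refl , refl) = inj₂ (inj₁ here , Sum.[ inj₂ , proj₂ ] rest′)
  ...   | inj₂ (refl , refl) = inj₂ (inj₂ here , Sum.[ inj₁ , proj₂ ] rest′)

  ~-split : Joins ends i x y → x ~[ G ] c → x ~[ G - i ] c ⊎ y ~[ G - i ] c
  ~-split ji x~c with ~-∪⁅⁆ ji (~-mono p⊆p-x∪⁅x⁆ x~c)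
  ... | inj₁ x~c′ = inj₁ x~c′
  ... | inj₂ (_ , ends~c) = ends~c

  record Separates (G : Subset m) (b : Fin m) (u v : Fin n) : Set where
    constructor separates
    field
      end-u end-v : Fin n
      joins       : Joins ends b end-u end-v
      u-side      : u ~[ G - b ] end-u
      v-side      : v ~[ G - b ] end-v

  Separates-mono : G ⊆ Z → Separates G b u v → Separates Z b u v
  Separates-mono G⊆Z (separates end-u end-v joins u-side v-side) =
    separates end-u end-v joins (~-mono (p⊆q⇒p-x⊆q-x G⊆Z) u-side) (~-mono (p⊆q⇒p-x⊆q-x G⊆Z) v-side)

  first-exit : ¬ u ~[ G ∩ S ] v → u ~[ G ∩ S ] w → w ~[ G ] v →
               (∃ λ b → b ∈ G × b ∉ S × Separates G b u v) ⊎ (∃ λ i → i ∈ G × u ~[ G - i ] v)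
  first-exit e-ends≁ u~w here = ⊥-elim (e-ends≁ u~w)
  first-exit {S = S} e-ends≁ u~w (step i i∈G ji rest) with i ∈? S
  ... | yes i∈S = first-exit e-ends≁ (~-trans u~w (~-edge (x∈p∩q⁺ (i∈G , i∈S)) ji)) rest
  ... | no i∉S with ~-split ji (step i i∈G ji rest)
  ...   | inj₁ w~v = inj₂ (i , i∈G , ~-trans (~-mono (x∉q⇒p∩q⊆p-x i∉S) u~w) w~v)
  ...   | inj₂ w′~v = inj₁ (i , i∈G , i∉S ,
                            separates _ _ ji (~-mono (x∉q⇒p∩q⊆p-x i∉S) u~w) (~-sym w′~v))

  separating-edge : ¬ u ~[ G ∩ S ] v → u ~[ G ] v → ∃ λ b → b ∈ G × b ∉ S × Separates G b u v
  separating-edge = go (<-wellFounded _)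
    where
    go : Acc _<_ ∣ G ∣ → ¬ u ~[ G ∩ S ] v → u ~[ G ] v → ∃ λ b → b ∈ G × b ∉ S × Separates G b u v
    go (acc smaller) e-ends≁ u~v with first-exit e-ends≁ here u~v
    ... | inj₁ found = found
    ... | inj₂ (i , i∈G , u~v′)
          with go (smaller (x∈p⇒∣p-x∣<∣p∣ i∈G))
                  (λ u~v″ → e-ends≁ (~-mono (p⊆q⇒p∩r⊆q∩r (p─q⊆p _ _)) u~v″)) u~v′
    ...   | b , b∈G-i , b∉S , sep =
            b , p─q⊆p _ _ b∈G-i , b∉S , Separates-mono (p─q⊆p _ _) sep

  module Exchange {T e b} (T-tree : IsSpanningTree ends T) (e∉T : e ∉ T) (b∈T : b ∈ T)
                  (sep : Separates T b (proj₁ (ends e)) (proj₂ (ends e))) where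
    open Separates sep

    T′ : Subset m
    T′ = (T ∪ ⁅ e ⁆) - b

    T-b⊆T′ : T - b ⊆ T′
    T-b⊆T′ = p⊆q⇒p-x⊆q-x (p⊆p∪q _)

    e∈T′ : e ∈ T′
    e∈T′ = x∈p∧x≢y⇒x∈p-y (x∈p∪q⁺ (inj₂ (x∈⁅x⁆ e))) λ { refl → e∉T b∈T }

    bypass : end-u ~[ T′ ] end-v
    bypass = ~-trans (~-sym (~-mono T-b⊆T′ u-side)) (step e e∈T′ (joins-ends e) (~-mono T-b⊆T′ v-side))

    onCycle : OnCycle ends (T ∪ ⁅ e ⁆) b
    onCycle = x∈p∪q⁺ (inj₁ b∈T) , ~-across joins (joins-ends b) bypass

    connected : Connected T′
    connected a c = lift (proj₁ T-tree a c)
      where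
      lift : ∀ {a c} → a ~[ T ] c → a ~[ T′ ] c
      lift here = here
      lift (step i i∈T ji rest) with i ≟ b
      ... | yes refl = ~-trans (~-across joins ji bypass) (lift rest)
      ... | no i≢b = step i (T-b⊆T′ (x∈p∧x≢y⇒x∈p-y i∈T i≢b)) ji (lift rest)

    T′-elim : ∀ {j} → j ∈ T′ → (j ∈ T ⊎ j ≡ e) × j ≢ b
    T′-elim j∈T′ = map₁ x∈p∪⁅y⁆⇒x∈p⊎x≡y (x∈p-y⇒x∈p×x≢y j∈T′)

    T′-e⊆T-b : T′ - e ⊆ T - b
    T′-e⊆T-b j∈ with x∈p-y⇒x∈p×x≢y j∈
    ... | j∈T′ , j≢e with T′-elim j∈T′
    ...   | inj₁ j∈T , j≢b = x∈p∧x≢y⇒x∈p-y j∈T j≢b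
    ...   | inj₂ j≡e , _ = ⊥-elim (j≢e j≡e)

    T′-i⊆T-b-i∪e : ∀ {i} → T′ - i ⊆ ((T - b) - i) ∪ ⁅ e ⁆
    T′-i⊆T-b-i∪e j∈ with x∈p-y⇒x∈p×x≢y j∈
    ... | j∈T′ , j≢i with T′-elim j∈T′
    ...   | inj₁ j∈T , j≢b = x∈p∪q⁺ (inj₁ (x∈p∧x≢y⇒x∈p-y (x∈p∧x≢y⇒x∈p-y j∈T j≢b) j≢i))
    ...   | inj₂ refl , _ = x∈p∪q⁺ (inj₂ (x∈⁅x⁆ e))

    e-ends≁ : ¬ proj₁ (ends e) ~[ T - b ] proj₂ (ends e)
    e-ends≁ u~v = acyclic-at (proj₂ T-tree) b∈T joins (~-trans (~-sym u-side) (~-trans u~v v-side))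

    -- A walk in T′ - i between the ends of i ∈ T - b that avoids e lies in the tree T;
    -- one that uses e puts both ends of e on the same side of b in T - b.
    acyclic-outside-e : ∀ {i} → i ∈ T - b → ¬ proj₁ (ends i) ~[ T′ - i ] proj₂ (ends i)
    acyclic-outside-e {i} i∈T-b i₁~i₂ = cases (~-∪⁅⁆ (joins-ends e) (~-mono T′-i⊆T-b-i∪e i₁~i₂))
      where
      i₁ i₂ e₁ e₂ : Fin n
      i₁ = proj₁ (ends i)
      i₂ = proj₂ (ends i)
      e₁ = proj₁ (ends e)
      e₂ = proj₂ (ends e)
      T-b-i : Subset m
      T-b-i = (T - b) - i
      T-b-i⊆T-b : T-b-i ⊆ T - b
      T-b-i⊆T-b = p─q⊆p _ _
      i₁≁i₂ : ¬ i₁ ~[ T-b-i ] i₂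
      i₁≁i₂ = acyclic-at (proj₂ T-tree) (p─q⊆p _ _ i∈T-b) (joins-ends i)
            ∘ ~-mono (p⊆q⇒p-x⊆q-x (p─q⊆p _ _))
      i₁~i₂′ : i₁ ~[ T - b ] i₂
      i₁~i₂′ = ~-edge i∈T-b (joins-ends i)
      lift : ∀ {a c} → a ~[ T-b-i ] c → a ~[ T - b ] c
      lift = ~-mono T-b-i⊆T-b
      cases : i₁ ~[ T-b-i ] i₂ ⊎ ((i₁ ~[ T-b-i ] e₁ ⊎ i₁ ~[ T-b-i ] e₂) × (e₁ ~[ T-b-i ] i₂ ⊎ e₂ ~[ T-b-i ] i₂)) →
              ⊥
      cases (inj₁ i₁~i₂) = i₁≁i₂ i₁~i₂
      cases (inj₂ (inj₁ i₁~e₁ , inj₁ e₁~i₂)) = i₁≁i₂ (~-trans i₁~e₁ e₁~i₂)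
      cases (inj₂ (inj₂ i₁~e₂ , inj₂ e₂~i₂)) = i₁≁i₂ (~-trans i₁~e₂ e₂~i₂)
      cases (inj₂ (inj₁ i₁~e₁ , inj₂ e₂~i₂)) =
        e-ends≁ (~-trans (lift (~-sym i₁~e₁)) (~-trans i₁~i₂′ (lift (~-sym e₂~i₂))))
      cases (inj₂ (inj₂ i₁~e₂ , inj₁ e₁~i₂)) =
        e-ends≁ (~-trans (lift e₁~i₂) (~-trans (~-sym i₁~i₂′) (lift i₁~e₂)))

    acyclic : Acyclic T′
    acyclic i i∈T′ with T′-elim i∈T′
    ... | inj₂ refl , _ = λ u~v → e-ends≁ (~-mono T′-e⊆T-b u~v)
    ... | inj₁ i∈T , i≢b = acyclic-outside-e (x∈p∧x≢y⇒x∈p-y i∈T i≢b)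

    spanning : IsSpanningTree ends T′
    spanning = connected , acyclic

  connected⊆acyclic⇒≡ : Connected S → Acyclic T → S ⊆ T → S ≡ T
  connected⊆acyclic⇒≡ {S} {T} S-connected T-acyclic S⊆T = ⊆-antisym S⊆T T⊆S
    where
    T⊆S : T ⊆ S
    T⊆S {j} j∈T with j ∈? S
    ... | yes j∈S = j∈S
    ... | no j∉S = ⊥-elim (T-acyclic j j∈T (~-mono S⊆T-j (S-connected _ _)))
      where
      S⊆T-j : S ⊆ T - j
      S⊆T-j i∈S = x∈p∧x≢y⇒x∈p-y (S⊆T i∈S) λ { refl → j∉S i∈S }

module Enumeration {n m p} (H : Halin n m p) (e : Fin p → Fin m) (e-ordering : IsCycleOrdering H e)
                   (S : Subset m) (S-tree : IsSpanningTree (Halin.ends H) S) where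
  open Halin H
  open Walks ends

  record Stage (k : ℕ) : Set where
    field
      tree              : Subset m
      tree-spanning     : IsSpanningTree ends tree
      tree-listed       : ListOutputs H e tree
      REC-listed        : ∀ j → k ≤ toℕ j → ∀ {S′} → RecOutputs H e tree j S′ → ListOutputs H e S′
      cycle-edges-in-S  : ∀ j → e j ∈ tree → e j ∈ S × toℕ j < k
      cycle-edges-taken : ∀ j → e j ∈ S → toℕ j < k → e j ∈ tree
      tree-edges-kept   : ∀ {x} → x ∈ T → x ∈ S → x ∈ tree

  T-disjoint-C : ∀ {x} → x ∈ T → x ∉ C
  T-disjoint-C {x} x∈T x∈C with T⊎C x
  ... | inj₁ (_ , x∉C) = x∉C x∈C
  ... | inj₂ (x∉T , _) = x∉T x∈T

  initial : Stage 0
  initial = record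
    { tree              = T
    ; tree-spanning     = T-tree
    ; tree-listed       = output-T
    ; REC-listed        = λ j _ → via-REC j
    ; cycle-edges-in-S  = λ j ej∈T → ⊥-elim (T-disjoint-C ej∈T (proj₁ (proj₂ e-ordering) j))
    ; cycle-edges-taken = λ _ _ ()
    ; tree-edges-kept   = λ x∈T _ → x∈T
    }

  below-suc : ∀ {i j : Fin p} → toℕ i < suc (toℕ j) → toℕ i < toℕ j ⊎ i ≡ j
  below-suc i<1+j = Sum.map₂ toℕ-injective (m<1+n⇒m<n∨m≡n i<1+j)

  skip : ∀ j → e j ∉ S → Stage (toℕ j) → Stage (suc (toℕ j))
  skip j ej∉S stage = record
    { tree              = tree
    ; tree-spanning     = tree-spanning
    ; tree-listed       = tree-listed
    ; REC-listed        = λ i j<i → REC-listed i (<⇒≤ j<i)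
    ; cycle-edges-in-S  = λ i ei∈ → map₂ m<n⇒m<1+n (cycle-edges-in-S i ei∈)
    ; cycle-edges-taken = taken
    ; tree-edges-kept   = tree-edges-kept
    }
    where
    open Stage stage
    taken : ∀ i → e i ∈ S → toℕ i < suc (toℕ j) → e i ∈ tree
    taken i ei∈S i<1+j with below-suc i<1+j
    ... | inj₁ i<j = cycle-edges-taken i ei∈S i<j
    ... | inj₂ refl = ⊥-elim (ej∉S ei∈S)

  swap : ∀ j → e j ∈ S → Stage (toℕ j) → Stage (suc (toℕ j))
  swap j ej∈S stage = swap-out (separating-edge ej-ends≁ (proj₁ tree-spanning _ _))
    where
    open Stage stage
    ej∉tree : e j ∉ tree
    ej∉tree ej∈ = <-irrefl refl (proj₂ (cycle-edges-in-S j ej∈))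
    ej-ends≁ : ¬ proj₁ (ends (e j)) ~[ tree ∩ S ] proj₂ (ends (e j))
    ej-ends≁ = proj₂ S-tree (e j) ej∈S ∘ ~-mono (x∉p⇒p∩q⊆q-x ej∉tree)
    swap-out : (∃ λ b → b ∈ tree × b ∉ S × Separates tree b (proj₁ (ends (e j))) (proj₂ (ends (e j)))) →
               Stage (suc (toℕ j))
    swap-out (b , b∈tree , b∉S , sep) = record
      { tree              = T′
      ; tree-spanning     = spanning
      ; tree-listed       = REC-listed j ≤-refl (output b onCycle b∉C)
      ; REC-listed        = λ i j<i → REC-listed j ≤-refl ∘ recurse b onCycle b∉C i j<i
      ; cycle-edges-in-S  = in-S
      ; cycle-edges-taken = taken
      ; tree-edges-kept   = λ x∈T x∈S → kept (tree-edges-kept x∈T x∈S) x∈S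
      }
      where
      open Exchange tree-spanning ej∉tree b∈tree sep
      b∉C : b ∉ C
      b∉C b∈C with proj₂ (proj₂ e-ordering) b b∈C
      ... | i , refl = b∉S (proj₁ (cycle-edges-in-S i b∈tree))
      kept : ∀ {x} → x ∈ tree → x ∈ S → x ∈ T′
      kept x∈tree x∈S = T-b⊆T′ (x∈p∧x≢y⇒x∈p-y x∈tree λ { refl → b∉S x∈S })
      in-S : ∀ i → e i ∈ T′ → e i ∈ S × toℕ i < suc (toℕ j)
      in-S i ei∈T′ with T′-elim ei∈T′
      ... | inj₁ ei∈tree , _ = map₂ m<n⇒m<1+n (cycle-edges-in-S i ei∈tree)
      ... | inj₂ ei≡ej , _ with proj₁ e-ordering ei≡ej
      ...   | refl = ej∈S , ≤-refl
      taken : ∀ i → e i ∈ S → toℕ i < suc (toℕ j) → e i ∈ T′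
      taken i ei∈S i<1+j with below-suc i<1+j
      ... | inj₁ i<j = kept (cycle-edges-taken i ei∈S i<j) ei∈S
      ... | inj₂ refl = e∈T′

  advance : ∀ j → Stage (toℕ j) → Stage (suc (toℕ j))
  advance j with e j ∈? S
  ... | yes ej∈S = swap j ej∈S
  ... | no ej∉S = skip j ej∉S

  stage : ∀ k → k ≤ p → Stage k
  stage zero _ = initial
  stage (suc k) k<p = subst (Stage ∘ suc) (toℕ-fromℕ< k<p)
                            (advance (fromℕ< k<p) (subst Stage (sym (toℕ-fromℕ< k<p)) (stage k (<⇒≤ k<p))))

  S-listed : ListOutputs H e S
  S-listed = subst (ListOutputs H e) (sym S≡tree) tree-listed
    where
    open Stage (stage p ≤-refl)
    S⊆tree : S ⊆ tree
    S⊆tree {x} x∈S with T⊎C x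
    ... | inj₁ (x∈T , _) = tree-edges-kept x∈T x∈S
    ... | inj₂ (_ , x∈C) with proj₂ (proj₂ e-ordering) x x∈C
    ...   | j , refl = cycle-edges-taken j x∈S (toℕ<n j)
    S≡tree : S ≡ tree
    S≡tree = connected⊆acyclic⇒≡ (proj₁ S-tree) (proj₂ tree-spanning) S⊆tree

theorem1 : ∀ {n m p} (H : Halin n m p) (e : Fin p → Fin m) → IsCycleOrdering H e →
    ∀ (S : Subset m) → IsSpanningTree (Halin.ends H) S → ListOutputs H e S
theorem1 H e e-ordering S S-tree = Enumeration.S-listed H e e-ordering S S-tree
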